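{- Let $p$ be a prime. Every $p$-$T_0T^\ast$-perfect number $n>1$ has the form $n=p_1^{2p-1}$ for some prime $p_1$.
   Context: $T(m)$ denotes the product of all positive divisors of $m$. A divisor $d$ of $m$ is unitary if $\gcd(d,m/d)=1$, and $T^\ast(m)$ denotes the product of all unitary divisors of $m$. For an integer $k\ge 2$, an integer $n>1$ is called $k$-$T_0T^\ast$-perfect if $T(T^\ast(n))=n^k$. -}

module Defs where

open import Data.Nat using (ℕ; suc; _*_; _^_; _<_)
open import Data.Nat.Divisibility using (_∣_; _∣?_)
open import Data.Nat.GCD using (gcd)
open import Data.Nat.DivMod using (_/_)
open import Data.Nat.Properties using (_≟_)
open import Data.List using (List; filter; upTo; map)
open import Data.Nat.ListAction using (product)
open import Relation.Binary.PropositionalEquality using (_≡_)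

range1 : ℕ → List ℕ
range1 m = map suc (upTo m)

-- list of all positive divisors of m (empty for m = 0)
divisors : ℕ → List ℕ
divisors m = filter (λ d → d ∣? m) (range1 m)

-- d is a unitary divisor of m : d ∣ m and gcd(d, m/d) = 1
-- (d = suc d' ranges over 1..m, so d is nonzero)
unitaryDivisors : ℕ → List ℕ
unitaryDivisors m =
  map suc (filter (λ d' → gcd (suc d') (m / suc d') ≟ 1)
                  (filter (λ d' → suc d' ∣? m) (upTo m)))

T : ℕ → ℕ
T m = product (divisors m)

T* : ℕ → ℕ
T* m = product (unitaryDivisors m)

-- n is k-T0T*-perfect (k ≥ 2, n > 1) iff T(T*(n)) = n^k
IsKT0T*Perfect : ℕ → ℕ → Set
IsKT0T*Perfect k n = T (T* n) ≡ n ^ k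

-- Pairing each divisor d of m with its cofactor m / d gives T(m)² = m^τ(m), and likewise
-- T*(m)² = m^τ*(m). For m > 1 this pairing has no fixed point on unitary divisors, so
-- τ*(n) = 2w and T*(n) = n^w; then T(T*(n)) = n^p becomes w · τ(n^w) = 2p.
-- Write n = q^(a+1) · e with q prime and q ∤ e. If e = 1, the only unitary divisors of n are
-- 1 and n, so w = 1 and τ(n) = a + 2 = 2p. If e > 1, n has at least four unitary divisors,
-- so w ≥ 2, while τ(n^w) = (1 + (a+1) w) · τ(e^w) is a product of two factors ≥ 2:
-- but 2p is not a product of three factors ≥ 2.

module Submission where

open import Defs
open import Data.Nat using (ℕ; zero; suc; _+_; _*_; _^_; _∸_; _≤_; _<_; _<?_; s≤s; z≤n; z<s;
  NonZero; ≢-nonZero; ≢-nonZero⁻¹; >-nonZero; n>1⇒nonTrivial)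
open import Data.Nat.Properties
open import Data.Nat.Divisibility
open import Data.Nat.DivMod using (_/_; m*n/n≡m; m*[n/m]≡n; n/n≡1)
open import Data.Nat.GCD using (gcd; gcd[m,n]∣m; gcd[m,n]∣n; gcd-greatest)
open import Data.Nat.Coprimality using (Coprime; coprime-divisor; coprime⇒gcd≡1; gcd≡1⇒coprime)
import Data.Nat.Coprimality as Coprime
open import Data.Nat.Primality
  using (Prime; euclidsLemma; prime⇒irreducible; prime⇒nonZero; composite-≢; prime⇒¬composite)
open import Data.Nat.Primality.Factorisation using (factorise; PrimeFactorisation)
open import Data.Nat.Induction using (<-wellFounded)
open import Data.Nat.ListAction using (product)
open import Data.Nat.ListAction.Properties using (product-↭)
open import Data.List using (List; []; _∷_; length; filter; map; upTo; cartesianProduct)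
open import Data.List.Properties using (length-filter; length-map; length-++; length-upTo; map-id)
open import Data.List.Membership.Propositional using (_∈_)
import Data.List.Membership.DecPropositional as DecMembership
open import Data.List.Membership.Propositional.Properties
  using (∈-filter⁻; ∈-filter⁺; ∈-map⁻; ∈-map⁺; ∈-upTo⁺; ∈-upTo⁻; ∈-cartesianProduct⁺; ∈-cartesianProduct⁻)
open import Data.List.Membership.Propositional.Properties.WithK using (unique∧set⇒bag)
open import Data.List.Relation.Binary.BagAndSetEquality using (∼bag⇒↭)
open import Data.List.Relation.Binary.Permutation.Propositional using (_↭_; ↭-sym)
open import Data.List.Relation.Binary.Permutation.Propositional.Properties using (↭-length)
open import Data.List.Relation.Unary.All as All using (All; []; _∷_)
import Data.List.Relation.Unary.All.Properties as All
open import Data.List.Relation.Unary.AllPairs using ([]; _∷_)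
open import Data.List.Relation.Unary.Any using (here; there)
open import Data.List.Relation.Unary.Unique.Propositional using (Unique)
import Data.List.Relation.Unary.Unique.Propositional.Properties as Unique
open import Data.Product using (Σ; ∃; ∃₂; _×_; _,_; proj₁; proj₂; uncurry)
open import Data.Sum using (inj₁; inj₂)
open import Function.Base using (id; _∘_)
open import Function.Bundles using (mk⇔)
open import Induction.WellFounded using (Acc; acc)
open import Level using (0ℓ)
open import Relation.Binary.Definitions using (DecidableEquality; tri<; tri≈; tri>)
open import Relation.Binary.PropositionalEquality
open import Relation.Nullary using (¬_; yes; no; contradiction)
open import Relation.Unary using (Pred; Decidable)
open import Relation.Unary.Properties using (∁?)
open import Algebra.Properties.CommutativeSemigroup *-commutativeSemigroup
  using (interchange; xy∙z≈xz∙y)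

-- Lists without duplicates

private
  variable
    A B : Set
    xs ys : List A

unique-↭ : Unique xs → Unique ys →
           (∀ {z} → z ∈ xs → z ∈ ys) → (∀ {z} → z ∈ ys → z ∈ xs) → xs ↭ ys
unique-↭ xs! ys! to from = ∼bag⇒↭ (unique∧set⇒bag xs! ys! (mk⇔ to from))

module _ {A : Set} (_≟_ : DecidableEquality A) where
  open DecMembership _≟_ using (_∈?_)

  unique-⊆⇒length-≤ : {xs ys : List A} → Unique xs → Unique ys → (∀ {z} → z ∈ xs → z ∈ ys) →
                      length xs ≤ length ys
  unique-⊆⇒length-≤ {xs} {ys} xs! ys! xs⊆ys =
    subst (_≤ length ys) (sym (↭-length xs↭ys∩xs)) (length-filter (_∈? xs) ys)
    where
    xs↭ys∩xs : xs ↭ filter (_∈? xs) ys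
    xs↭ys∩xs = unique-↭ xs! (Unique.filter⁺ (_∈? xs) ys!)
      (λ z∈xs → ∈-filter⁺ (_∈? xs) (xs⊆ys z∈xs) z∈xs)
      (λ z∈ → proj₂ (∈-filter⁻ (_∈? xs) {xs = ys} z∈))

unique-map⁺ : (f : A → B) → (∀ {x y} → x ∈ xs → y ∈ xs → f x ≡ f y → x ≡ y) →
              Unique xs → Unique (map f xs)
unique-map⁺ f f-inj [] = []
unique-map⁺ f f-inj (x∉xs ∷ xs!) =
  All.map⁺ (All.tabulate λ y∈xs fx≡fy →
    All.lookup x∉xs y∈xs (f-inj (here refl) (there y∈xs) fx≡fy))
  ∷ unique-map⁺ f (λ x∈ y∈ → f-inj (there x∈) (there y∈)) xs!

length-filter-∁ : ∀ {P : Pred A 0ℓ} (P? : Decidable P) xs →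
  length (filter P? xs) + length (filter (∁? P?) xs) ≡ length xs
length-filter-∁ P? [] = refl
length-filter-∁ P? (x ∷ xs) with P? x
... | yes _ = cong suc (length-filter-∁ P? xs)
... | no  _ = trans (+-suc _ _) (cong suc (length-filter-∁ P? xs))

length-cartesianProduct : (xs : List A) (ys : List B) →
  length (cartesianProduct xs ys) ≡ length xs * length ys
length-cartesianProduct []       ys = refl
length-cartesianProduct (x ∷ xs) ys = trans (length-++ (map (x ,_) ys))
  (cong₂ _+_ (length-map (x ,_) ys) (length-cartesianProduct xs ys))

product-map-* : (f g : A → ℕ) (xs : List A) →
  product (map f xs) * product (map g xs) ≡ product (map (λ x → f x * g x) xs)
product-map-* f g []       = refl
product-map-* f g (x ∷ xs) = trans (interchange (f x) _ (g x) _)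
  (cong (f x * g x *_) (product-map-* f g xs))

product-map-const : (f : A → ℕ) {m : ℕ} (xs : List A) → (∀ {x} → x ∈ xs → f x ≡ m) →
  product (map f xs) ≡ m ^ length xs
product-map-const f []       _    = refl
product-map-const f (x ∷ xs) f≡m =
  cong₂ _*_ (f≡m (here refl)) (product-map-const f xs (f≡m ∘ there))

record IsInvolutionOn (σ : A → A) (xs : List A) : Set where
  field
    closed     : ∀ {x} → x ∈ xs → σ x ∈ xs
    involutive : ∀ {x} → x ∈ xs → σ (σ x) ≡ x

  injective : ∀ {x y} → x ∈ xs → y ∈ xs → σ x ≡ σ y → x ≡ y
  injective x∈ y∈ σx≡σy = trans (sym (involutive x∈)) (trans (cong σ σx≡σy) (involutive y∈))

module _ {σ : A → A} {xs : List A} (xs! : Unique xs) (inv : IsInvolutionOn σ xs) where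
  open IsInvolutionOn inv

  involution-↭ : map σ xs ↭ xs
  involution-↭ = unique-↭ (unique-map⁺ σ injective xs!) xs! to from
    where
    to : ∀ {z} → z ∈ map σ xs → z ∈ xs
    to z∈ with ∈-map⁻ σ z∈
    ... | x , x∈ , refl = closed x∈
    from : ∀ {z} → z ∈ xs → z ∈ map σ xs
    from z∈ = subst (_∈ map σ xs) (involutive z∈) (∈-map⁺ σ (closed z∈))

product-involution : {σ : ℕ → ℕ} {xs : List ℕ} {m : ℕ} → Unique xs → IsInvolutionOn σ xs →
  (∀ {x} → x ∈ xs → x * σ x ≡ m) → product xs * product xs ≡ m ^ length xs
product-involution {σ} {xs} {m} xs! inv x*σx≡m = begin
  product xs * product xs                  ≡⟨ cong₂ _*_ (cong product (sym (map-id xs)))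
                                                        (product-↭ (↭-sym (involution-↭ xs! inv))) ⟩
  product (map id xs) * product (map σ xs) ≡⟨ product-map-* id σ xs ⟩
  product (map (λ x → x * σ x) xs)         ≡⟨ product-map-const _ xs x*σx≡m ⟩
  m ^ length xs                            ∎
  where open ≡-Reasoning

-- Elements with x < σ x are mapped by σ onto the remaining ones.
involution-fixpoint-free⇒even : {σ : ℕ → ℕ} {xs : List ℕ} → Unique xs → IsInvolutionOn σ xs →
  (∀ {x} → x ∈ xs → σ x ≢ x) → 2 ∣ length xs
involution-fixpoint-free⇒even {σ} {xs} xs! inv σx≢x =
  divides (length below) (begin
    length xs                         ≡⟨ sym (length-filter-∁ P? xs) ⟩
    length below + length above       ≡⟨ cong (length below +_) length-above ⟩
    length below + length below       ≡⟨ cong (length below +_) (sym (+-identityʳ _)) ⟩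
    2 * length below                  ≡⟨ *-comm 2 (length below) ⟩
    length below * 2                  ∎)
  where
  open ≡-Reasoning
  open IsInvolutionOn inv
  P? = λ x → x <? σ x
  below = filter P? xs
  above = filter (∁? P?) xs
  ∈-below⁻ : ∀ {x} → x ∈ below → x ∈ xs × x < σ x
  ∈-below⁻ = ∈-filter⁻ P? {xs = xs}
  ∈-above⁻ : ∀ {x} → x ∈ above → x ∈ xs × ¬ x < σ x
  ∈-above⁻ = ∈-filter⁻ (∁? P?) {xs = xs}
  σ[below]↭above : map σ below ↭ above
  σ[below]↭above = unique-↭
    (unique-map⁺ σ (λ x∈ y∈ → injective (proj₁ (∈-below⁻ x∈)) (proj₁ (∈-below⁻ y∈)))
                   (Unique.filter⁺ P? xs!))
    (Unique.filter⁺ (∁? P?) xs!) to from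
    where
    to : ∀ {z} → z ∈ map σ below → z ∈ above
    to z∈ with ∈-map⁻ σ z∈
    ... | x , x∈ , refl with ∈-below⁻ x∈
    ... | x∈xs , x<σx = ∈-filter⁺ (∁? P?) (closed x∈xs)
          (λ σx<σσx → <-asym x<σx (subst (σ x <_) (involutive x∈xs) σx<σσx))
    from : ∀ {z} → z ∈ above → z ∈ map σ below
    from {z} z∈ with ∈-above⁻ z∈
    ... | z∈xs , z≮σz = subst (_∈ map σ below) (involutive z∈xs)
          (∈-map⁺ σ (∈-filter⁺ P? (closed z∈xs)
            (subst (σ z <_) (sym (involutive z∈xs)) (≤∧≢⇒< (≮⇒≥ z≮σz) (σx≢x z∈xs)))))
  length-above : length above ≡ length below
  length-above = trans (sym (↭-length σ[below]↭above)) (length-map σ below)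

^-distribʳ-* : ∀ m n k → (m * n) ^ k ≡ m ^ k * n ^ k
^-distribʳ-* m n zero    = refl
^-distribʳ-* m n (suc k) = trans (cong (m * n *_) (^-distribʳ-* m n k)) (interchange m n (m ^ k) (n ^ k))

m*m≡n*n⇒m≡n : ∀ {m n} → m * m ≡ n * n → m ≡ n
m*m≡n*n⇒m≡n {m} {n} m²≡n² with <-cmp m n
... | tri< m<n _ _ = contradiction m²≡n² (<⇒≢ (*-mono-< m<n m<n))
... | tri≈ _ m≡n _ = m≡n
... | tri> _ _ n<m = contradiction (sym m²≡n²) (<⇒≢ (*-mono-< n<m n<m))

^-injectiveʳ : ∀ {m a b} → 1 < m → m ^ a ≡ m ^ b → a ≡ b
^-injectiveʳ {m} {a} {b} 1<m mᵃ≡mᵇ with <-cmp a b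
... | tri< a<b _ _ = contradiction mᵃ≡mᵇ (<⇒≢ (^-monoʳ-< m 1<m a<b))
... | tri≈ _ a≡b _ = a≡b
... | tri> _ _ b<a = contradiction (sym mᵃ≡mᵇ) (<⇒≢ (^-monoʳ-< m 1<m b<a))

^-monoʳ-∣ : ∀ q {i a} → i ≤ a → q ^ i ∣ q ^ a
^-monoʳ-∣ q {i} {a} i≤a = divides (q ^ (a ∸ i)) (begin
  q ^ a               ≡⟨ cong (q ^_) (m+[n∸m]≡n i≤a) ⟨
  q ^ (i + (a ∸ i))   ≡⟨ ^-distribˡ-+-* q i (a ∸ i) ⟩
  q ^ i * q ^ (a ∸ i) ≡⟨ *-comm (q ^ i) _ ⟩
  q ^ (a ∸ i) * q ^ i ∎)
  where open ≡-Reasoning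

prime⇒>1 : ∀ {q} → Prime q → 1 < q
prime⇒>1 {suc (suc _)} _ = s≤s (s≤s z≤n)

-- Euclid puts p into a, leaving b * c ∣ 2, or into b * c, forcing a = 2 and b * c = p.
nontrivial-a*[b*c]≢2*prime : ∀ {p a b c} → Prime p → 2 ≤ a → 2 ≤ b → 2 ≤ c → a * (b * c) ≢ 2 * p
nontrivial-a*[b*c]≢2*prime {p} {a} {b} {c} prime-p 2≤a 2≤b 2≤c a*bc≡2p
  with euclidsLemma a (b * c) prime-p (divides 2 a*bc≡2p)
... | inj₁ (divides k a≡kp) =
  contradiction (≤-trans (*-mono-≤ 2≤b 2≤c) (∣⇒≤ (divides k (sym k*bc≡2)))) λ { (s≤s (s≤s ())) }
  where
  instance _ = prime⇒nonZero prime-p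
  k*bc≡2 : k * (b * c) ≡ 2
  k*bc≡2 = *-cancelʳ-≡ _ 2 p (begin
    k * (b * c) * p   ≡⟨ xy∙z≈xz∙y k (b * c) p ⟩
    k * p * (b * c)   ≡⟨ cong (_* (b * c)) a≡kp ⟨
    a * (b * c)       ≡⟨ a*bc≡2p ⟩
    2 * p             ∎)
    where open ≡-Reasoning
... | inj₂ (divides k bc≡kp) = prime⇒¬composite prime-p
  (composite-≢ b {{n>1⇒nonTrivial 2≤b}} (<⇒≢ b<p) (divides c (trans (sym bc≡p) (*-comm b c))))
  where
  instance _ = prime⇒nonZero prime-p
  a*k≡2 : a * k ≡ 2
  a*k≡2 = *-cancelʳ-≡ _ 2 p (trans (*-assoc a k p) (trans (cong (a *_) (sym bc≡kp)) a*bc≡2p))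
  a≡2 : a ≡ 2
  a≡2 = ≤-antisym (∣⇒≤ (divides k (trans (sym a*k≡2) (*-comm a k)))) 2≤a
  k≡1 : k ≡ 1
  k≡1 = *-cancelˡ-≡ k 1 2 (trans (cong (_* k) (sym a≡2)) a*k≡2)
  bc≡p : b * c ≡ p
  bc≡p = trans bc≡kp (trans (cong (_* p) k≡1) (*-identityˡ p))
  b<p : b < p
  b<p = subst (b <_) bc≡p (m<m*n b c {{>-nonZero (<-trans z<s 2≤b)}} 2≤c)

∃-prime-divisor : ∀ {n} → 1 < n → ∃ λ q → Prime q × q ∣ n
∃-prime-divisor {n@(suc _)} 1<n = go (PrimeFactorisation.factors fn)
  (PrimeFactorisation.isFactorisation fn) (PrimeFactorisation.factorsPrime fn)
  where
  fn = factorise n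
  go : ∀ qs → n ≡ product qs → All Prime qs → ∃ λ q → Prime q × q ∣ n
  go []       n≡1 _          = contradiction (sym n≡1) (<⇒≢ 1<n)
  go (q ∷ qs) n≡  (prime-q ∷ _) = q , prime-q , divides (product qs) (trans n≡ (*-comm q _))

prime-∤⇒coprime : ∀ {q e} → Prime q → q ∤ e → Coprime e q
prime-∤⇒coprime prime-q q∤e (i∣e , i∣q) with prime⇒irreducible prime-q i∣q
... | inj₁ i≡1 = i≡1
... | inj₂ refl = contradiction i∣e q∤e

divide-out : ∀ {q} → 1 < q → ∀ n → .{{NonZero n}} → ∃₂ λ a e → n ≡ q ^ a * e × q ∤ e
divide-out {q} 1<q n = go n (<-wellFounded n)
  where
  go : ∀ n → Acc _<_ n → .{{NonZero n}} → ∃₂ λ a e → n ≡ q ^ a * e × q ∤ e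
  go n (acc rec) with q ∣? n
  ... | no  q∤n = 0 , n , sym (+-identityʳ n) , q∤n
  ... | yes (divides k refl) with go k (rec (m<m*n k q {{k≢0}} 1<q)) {{k≢0}}
    where k≢0 = m*n≢0⇒m≢0 k
  ... | a , e , k≡ , q∤e = suc a , e , (begin
    k * q             ≡⟨ *-comm k q ⟩
    q * k             ≡⟨ cong (q *_) k≡ ⟩
    q * (q ^ a * e)   ≡⟨ *-assoc q (q ^ a) e ⟨
    q ^ suc a * e     ∎) , q∤e
    where open ≡-Reasoning

prime-power-part : ∀ {q n} → 1 < q → q ∣ n → .{{NonZero n}} →
  ∃₂ λ a e → n ≡ q ^ suc a * e × q ∤ e
prime-power-part {q} {n} 1<q q∣n with divide-out 1<q n
... | zero  , e , n≡1*e , q∤e = contradiction (subst (q ∣_) (trans n≡1*e (*-identityˡ e)) q∣n) q∤e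
... | suc a , e , n≡ , q∤e    = a , e , n≡ , q∤e

∣-prime-power : ∀ {q d} → Prime q → ∀ a → d ∣ q ^ a → ∃ λ i → i ≤ a × d ≡ q ^ i
∣-prime-power         prime-q zero    d∣1 = 0 , z≤n , ∣1⇒≡1 d∣1
∣-prime-power {q} {d} prime-q (suc a) d∣qqᵃ with q ∣? d
... | no q∤d with ∣-prime-power prime-q a (coprime-divisor (prime-∤⇒coprime prime-q q∤d) d∣qqᵃ)
...   | i , i≤a , d≡qⁱ = i , m≤n⇒m≤1+n i≤a , d≡qⁱ
∣-prime-power {q} {d} prime-q (suc a) d∣qqᵃ | yes (divides d′ refl)
  with ∣-prime-power prime-q a
         (*-cancelˡ-∣ q {{prime⇒nonZero prime-q}} (subst (_∣ q * q ^ a) (*-comm d′ q) d∣qqᵃ))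
... | i , i≤a , d′≡qⁱ = suc i , s≤s i≤a , trans (*-comm d′ q) (cong (q *_) d′≡qⁱ)

prime-∤-^ : ∀ {q e} → Prime q → q ∤ e → ∀ k → q ∤ e ^ k
prime-∤-^ prime-q q∤e zero    q∣1 = <⇒≢ (prime⇒>1 prime-q) (sym (∣1⇒≡1 q∣1))
prime-∤-^ {e = e} prime-q q∤e (suc k) q∣eᵏ⁺¹ with euclidsLemma e (e ^ k) prime-q q∣eᵏ⁺¹
... | inj₁ q∣e  = q∤e q∣e
... | inj₂ q∣eᵏ = prime-∤-^ prime-q q∤e k q∣eᵏ

prime-power-coprime : ∀ {q e} → Prime q → q ∤ e → ∀ a → Coprime (q ^ a) e
prime-power-coprime {q} prime-q q∤e a (i∣qᵃ , i∣e) with ∣-prime-power prime-q a i∣qᵃ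
... | zero  , _ , i≡1  = i≡1
... | suc j , _ , refl = contradiction (∣-trans (m∣m*n (q ^ j)) i∣e) q∤e

coprime-∣ : ∀ {m n a b} → Coprime m n → a ∣ m → b ∣ n → Coprime a b
coprime-∣ m⊥n a∣m b∣n (i∣a , i∣b) = m⊥n (∣-trans i∣a a∣m , ∣-trans i∣b b∣n)

coprime-*-injectiveˡ : ∀ {m n a b a′ b′} → Coprime m n → a ∣ m → b ∣ n → a′ ∣ m → b′ ∣ n →
  a * b ≡ a′ * b′ → a ≡ a′
coprime-*-injectiveˡ {a = a} {b} {a′} {b′} m⊥n a∣m b∣n a′∣m b′∣n ab≡a′b′ = ∣-antisym
  (coprime-divisor (coprime-∣ m⊥n a∣m b′∣n)
    (divides b (trans (*-comm b′ a′) (trans (sym ab≡a′b′) (*-comm a b)))))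
  (coprime-divisor (coprime-∣ m⊥n a′∣m b∣n)
    (divides b′ (trans (*-comm b a) (trans ab≡a′b′ (*-comm a′ b′)))))

-- Write x = g * x′ with g = gcd x m; then x′ is coprime to m / g and divides (m / g) * n.
∣-*-split : ∀ {x m n} → .{{NonZero m}} → x ∣ m * n → ∃₂ λ a b → a ∣ m × b ∣ n × x ≡ a * b
∣-*-split {x} {m} {n} x∣mn with gcd x m | gcd[m,n]∣m x m | gcd[m,n]∣n x m | gcd-greatest {x} {m}
... | g | divides x′ x≡x′g | divides m′ m≡m′g | greatest =
  g , x′ , divides m′ m≡m′g , coprime-divisor x′⊥m′ x′∣m′n , trans x≡x′g (*-comm x′ g)
  where
  instance _ = ≢-nonZero (λ { refl → ≢-nonZero⁻¹ m (trans m≡m′g (*-zeroʳ m′)) })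
  x′⊥m′ : Coprime x′ m′
  x′⊥m′ {i} (i∣x′ , i∣m′) = ∣1⇒≡1 (*-cancelʳ-∣ g (subst (i * g ∣_) (sym (*-identityˡ g))
    (greatest (subst (i * g ∣_) (sym x≡x′g) (*-monoˡ-∣ g i∣x′))
              (subst (i * g ∣_) (sym m≡m′g) (*-monoˡ-∣ g i∣m′)))))
  x′∣m′n : x′ ∣ m′ * n
  x′∣m′n = *-cancelʳ-∣ g (subst₂ _∣_ x≡x′g (trans (cong (_* n) m≡m′g) (xy∙z≈xz∙y m′ g n)) x∣mn)

-- Divisors, unitary divisors and their cofactors

infixl 7 _÷_

-- Total division with junk value m ÷ 0 = 0; on d = suc d′ it is the cofactor m / d of unitaryDivisors.
_÷_ : ℕ → ℕ → ℕ
m ÷ zero  = 0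
m ÷ suc d = m / suc d

∣⇒nonZero : ∀ {d m} → .{{NonZero m}} → d ∣ m → NonZero d
∣⇒nonZero {zero}  {m} 0∣m = contradiction (0∣⇒≡0 0∣m) (≢-nonZero⁻¹ m)
∣⇒nonZero {suc _}     _   = _

m*n÷n≡m : ∀ m n .{{_ : NonZero n}} → m * n ÷ n ≡ m
m*n÷n≡m m (suc n) = m*n/n≡m m (suc n)

m*n÷m≡n : ∀ m n .{{_ : NonZero m}} → m * n ÷ m ≡ n
m*n÷m≡n m n = trans (cong (_÷ m) (*-comm m n)) (m*n÷n≡m n m)

n÷n≡1 : ∀ n .{{_ : NonZero n}} → n ÷ n ≡ 1
n÷n≡1 (suc n) = n/n≡1 (suc n)

*-÷-cancel : ∀ {d m} → d ∣ m → d * (m ÷ d) ≡ m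
*-÷-cancel {zero}  0∣m = sym (0∣⇒≡0 0∣m)
*-÷-cancel {suc _} d∣m = m*[n/m]≡n d∣m

÷-∣ : ∀ {d m} → d ∣ m → m ÷ d ∣ m
÷-∣ {zero}  0∣m = 0∣m
÷-∣ {suc _} d∣m = m/n∣m d∣m

÷-involutive : ∀ {d m} → .{{NonZero m}} → d ∣ m → m ÷ (m ÷ d) ≡ d
÷-involutive {d} {m} d∣m = begin
  m ÷ (m ÷ d)             ≡⟨ cong (_÷ (m ÷ d)) (trans (sym (*-÷-cancel d∣m)) (*-comm d (m ÷ d))) ⟩
  (m ÷ d) * d ÷ (m ÷ d)   ≡⟨ m*n÷m≡n (m ÷ d) d {{∣⇒nonZero (÷-∣ d∣m)}} ⟩
  d                       ∎
  where open ≡-Reasoning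

τ : ℕ → ℕ
τ m = length (divisors m)

τ* : ℕ → ℕ
τ* m = length (unitaryDivisors m)

∈-divisors⁻ : ∀ {d m} → d ∈ divisors m → d ∣ m
∈-divisors⁻ {m = m} d∈ = proj₂ (∈-filter⁻ (_∣? m) {xs = range1 m} d∈)

∈-divisors⁺ : ∀ {d m} → .{{NonZero m}} → d ∣ m → d ∈ divisors m
∈-divisors⁺ {d} {m} d∣m with ∣⇒nonZero d∣m
∈-divisors⁺ {suc d} {suc m} d∣m | _ = ∈-filter⁺ (_∣? suc m) (∈-map⁺ suc (∈-upTo⁺ (∣⇒≤ d∣m))) d∣m

divisors-unique : ∀ m → Unique (divisors m)
divisors-unique m = Unique.filter⁺ (_∣? m) (Unique.map⁺ suc-injective (Unique.upTo⁺ m))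

∈-unitaryDivisors⁻ : ∀ {d m} → d ∈ unitaryDivisors m → d ∣ m × Coprime d (m ÷ d)
∈-unitaryDivisors⁻ {m = m} d∈ with ∈-map⁻ suc d∈
... | d′ , d′∈ , refl
  with ∈-filter⁻ (λ d′ → gcd (suc d′) (m / suc d′) ≟ 1) {xs = filter (λ d′ → suc d′ ∣? m) (upTo m)} d′∈
... | d′∈′ , gcd≡1 =
  proj₂ (∈-filter⁻ (λ d′ → suc d′ ∣? m) {xs = upTo m} d′∈′) , gcd≡1⇒coprime gcd≡1

∈-unitaryDivisors⁺ : ∀ {d m} → .{{NonZero m}} → d ∣ m → Coprime d (m ÷ d) → d ∈ unitaryDivisors m
∈-unitaryDivisors⁺ {d} {m} d∣m coprime with ∣⇒nonZero d∣m
∈-unitaryDivisors⁺ {suc d} {suc m} d∣m coprime | _ =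
  ∈-map⁺ suc (∈-filter⁺ (λ d′ → gcd (suc d′) (suc m / suc d′) ≟ 1)
    (∈-filter⁺ (λ d′ → suc d′ ∣? suc m) (∈-upTo⁺ (∣⇒≤ d∣m)) d∣m) (coprime⇒gcd≡1 coprime))

unitaryDivisors-unique : ∀ m → Unique (unitaryDivisors m)
unitaryDivisors-unique m = Unique.map⁺ suc-injective
  (Unique.filter⁺ (λ d′ → gcd (suc d′) (m / suc d′) ≟ 1)
    (Unique.filter⁺ (λ d′ → suc d′ ∣? m) (Unique.upTo⁺ m)))

module _ {m : ℕ} .{{_ : NonZero m}} where

  cofactor-involution : IsInvolutionOn (m ÷_) (divisors m)
  cofactor-involution = record
    { closed     = ∈-divisors⁺ ∘ ÷-∣ ∘ ∈-divisors⁻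
    ; involutive = ÷-involutive ∘ ∈-divisors⁻
    }

  unitary-cofactor-involution : IsInvolutionOn (m ÷_) (unitaryDivisors m)
  unitary-cofactor-involution = record
    { closed     = closed
    ; involutive = ÷-involutive ∘ proj₁ ∘ ∈-unitaryDivisors⁻
    }
    where
    closed : ∀ {d} → d ∈ unitaryDivisors m → m ÷ d ∈ unitaryDivisors m
    closed {d} d∈ with ∈-unitaryDivisors⁻ d∈
    ... | d∣m , coprime = ∈-unitaryDivisors⁺ (÷-∣ d∣m)
          (subst (Coprime (m ÷ d)) (sym (÷-involutive d∣m)) (Coprime.sym coprime))

T-square : ∀ m → T m * T m ≡ m ^ τ m
T-square zero      = refl
T-square m@(suc _) =
  product-involution (divisors-unique m) cofactor-involution (*-÷-cancel ∘ ∈-divisors⁻)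

T*-square : ∀ m → T* m * T* m ≡ m ^ τ* m
T*-square zero      = refl
T*-square m@(suc _) = product-involution (unitaryDivisors-unique m) unitary-cofactor-involution
  (*-÷-cancel ∘ proj₁ ∘ ∈-unitaryDivisors⁻)

-- A unitary divisor equal to its cofactor is coprime to itself, hence 1, and then m = 1.
τ*-even : ∀ {m} → 1 < m → 2 ∣ τ* m
τ*-even {m@(suc _)} 1<m = involution-fixpoint-free⇒even
  (unitaryDivisors-unique m) unitary-cofactor-involution cofactor≢self
  where
  cofactor≢self : ∀ {d} → d ∈ unitaryDivisors m → m ÷ d ≢ d
  cofactor≢self {d} d∈ m÷d≡d with ∈-unitaryDivisors⁻ d∈
  ... | d∣m , coprime = <⇒≢ 1<m (sym (begin
    m              ≡⟨ sym (*-÷-cancel d∣m) ⟩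
    d * (m ÷ d)    ≡⟨ cong₂ _*_ d≡1 (trans m÷d≡d d≡1) ⟩
    1              ∎))
    where
    open ≡-Reasoning
    d≡1 = coprime (∣-refl , subst (_ ∣_) (sym m÷d≡d) ∣-refl)

-- Counting divisors

τ-prime-power : ∀ {q} → Prime q → ∀ a → τ (q ^ a) ≡ suc a
τ-prime-power {q} prime-q a = begin
  τ (q ^ a)                          ≡⟨ ↭-length powers↭divisors ⟨
  length (map (q ^_) (upTo (suc a))) ≡⟨ length-map (q ^_) (upTo (suc a)) ⟩
  length (upTo (suc a))              ≡⟨ length-upTo (suc a) ⟩
  suc a                              ∎
  where
  open ≡-Reasoning
  instance _ = >-nonZero (<-trans z<s (prime⇒>1 prime-q))
  instance _ = m^n≢0 q a
  powers↭divisors : map (q ^_) (upTo (suc a)) ↭ divisors (q ^ a)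
  powers↭divisors = unique-↭
    (Unique.map⁺ (^-injectiveʳ (prime⇒>1 prime-q)) (Unique.upTo⁺ (suc a)))
    (divisors-unique (q ^ a)) to from
    where
    to : ∀ {d} → d ∈ map (q ^_) (upTo (suc a)) → d ∈ divisors (q ^ a)
    to d∈ with ∈-map⁻ (q ^_) d∈
    ... | i , i∈ , refl = ∈-divisors⁺ (^-monoʳ-∣ q (≤-pred (∈-upTo⁻ i∈)))
    from : ∀ {d} → d ∈ divisors (q ^ a) → d ∈ map (q ^_) (upTo (suc a))
    from d∈ with ∣-prime-power prime-q a (∈-divisors⁻ d∈)
    ... | i , i≤a , refl = ∈-map⁺ (q ^_) (∈-upTo⁺ (s≤s i≤a))

τ-*-coprime : ∀ {m n} → .{{NonZero m}} → .{{NonZero n}} → Coprime m n → τ (m * n) ≡ τ m * τ n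
τ-*-coprime {m} {n} m⊥n = begin
  τ (m * n)                        ≡⟨ ↭-length products↭divisors ⟨
  length (map (uncurry _*_) pairs) ≡⟨ length-map (uncurry _*_) pairs ⟩
  length pairs                     ≡⟨ length-cartesianProduct (divisors m) (divisors n) ⟩
  τ m * τ n                        ∎
  where
  open ≡-Reasoning
  instance _ = m*n≢0 m n
  pairs = cartesianProduct (divisors m) (divisors n)
  ∈-pairs⁻ : ∀ {a b} → (a , b) ∈ pairs → a ∣ m × b ∣ n
  ∈-pairs⁻ ab∈ with ∈-cartesianProduct⁻ (divisors m) (divisors n) ab∈
  ... | a∈ , b∈ = ∈-divisors⁻ a∈ , ∈-divisors⁻ b∈
  *-injective : ∀ {x y} → x ∈ pairs → y ∈ pairs → uncurry _*_ x ≡ uncurry _*_ y → x ≡ y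
  *-injective {a , b} {a′ , b′} ab∈ a′b′∈ ab≡a′b′
    with ∈-pairs⁻ ab∈ | ∈-pairs⁻ a′b′∈
  ... | a∣m , b∣n | a′∣m , b′∣n = cong₂ _,_ a≡a′ (*-cancelˡ-≡ b b′ a {{∣⇒nonZero a∣m}}
          (trans ab≡a′b′ (cong (_* b′) (sym a≡a′))))
    where a≡a′ = coprime-*-injectiveˡ m⊥n a∣m b∣n a′∣m b′∣n ab≡a′b′
  products↭divisors : map (uncurry _*_) pairs ↭ divisors (m * n)
  products↭divisors = unique-↭
    (unique-map⁺ (uncurry _*_) *-injective
      (Unique.cartesianProduct⁺ (divisors-unique m) (divisors-unique n)))
    (divisors-unique (m * n)) to from
    where
    to : ∀ {d} → d ∈ map (uncurry _*_) pairs → d ∈ divisors (m * n)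
    to d∈ with ∈-map⁻ (uncurry _*_) d∈
    ... | (a , b) , ab∈ , refl = ∈-divisors⁺ (uncurry *-pres-∣ (∈-pairs⁻ ab∈))
    from : ∀ {d} → d ∈ divisors (m * n) → d ∈ map (uncurry _*_) pairs
    from d∈ with ∣-*-split (∈-divisors⁻ d∈)
    ... | a , b , a∣m , b∣n , refl = ∈-map⁺ (uncurry _*_)
          (∈-cartesianProduct⁺ (∈-divisors⁺ a∣m) (∈-divisors⁺ b∣n))

τ≥2 : ∀ {m} → 1 < m → 2 ≤ τ m
τ≥2 {m} 1<m = unique-⊆⇒length-≤ _≟_ ((<⇒≢ 1<m ∷ []) ∷ [] ∷ []) (divisors-unique m) ⊆divisors
  where
  instance _ = >-nonZero (<-trans z<s 1<m)
  ⊆divisors : ∀ {d} → d ∈ 1 ∷ m ∷ [] → d ∈ divisors m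
  ⊆divisors (here refl)         = ∈-divisors⁺ (1∣ m)
  ⊆divisors (there (here refl)) = ∈-divisors⁺ ∣-refl

τ*-coprime≥4 : ∀ {d e} → 1 < d → 1 < e → Coprime d e → 4 ≤ τ* (d * e)
τ*-coprime≥4 {d} {e} 1<d 1<e d⊥e = unique-⊆⇒length-≤ _≟_
  ((<⇒≢ 1<d ∷ <⇒≢ 1<e ∷ <⇒≢ (<-trans 1<d d<de) ∷ []) ∷ (d≢e ∷ <⇒≢ d<de ∷ []) ∷ (<⇒≢ e<de ∷ []) ∷ []
    ∷ [])
  (unitaryDivisors-unique (d * e)) ⊆unitary
  where
  instance
    _ = >-nonZero (<-trans z<s 1<d)
    _ = >-nonZero (<-trans z<s 1<e)
    _ = m*n≢0 d e
  d<de : d < d * e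
  d<de = m<m*n d e 1<e
  e<de : e < d * e
  e<de = subst (e <_) (*-comm e d) (m<m*n e d 1<d)
  d≢e : d ≢ e
  d≢e refl = <⇒≢ 1<d (sym (d⊥e (∣-refl , ∣-refl)))
  ⊆unitary : ∀ {x} → x ∈ 1 ∷ d ∷ e ∷ d * e ∷ [] → x ∈ unitaryDivisors (d * e)
  ⊆unitary (here refl) = ∈-unitaryDivisors⁺ {m = d * e} (1∣ _) (Coprime.1-coprimeTo _)
  ⊆unitary (there (here refl)) =
    ∈-unitaryDivisors⁺ (m∣m*n e) (subst (Coprime d) (sym (m*n÷m≡n d e)) d⊥e)
  ⊆unitary (there (there (here refl))) =
    ∈-unitaryDivisors⁺ (n∣m*n d) (subst (Coprime e) (sym (m*n÷n≡m d e)) (Coprime.sym d⊥e))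
  ⊆unitary (there (there (there (here refl)))) = ∈-unitaryDivisors⁺ ∣-refl
    (subst (Coprime (d * e)) (sym (n÷n≡1 (d * e))) (Coprime.sym (Coprime.1-coprimeTo _)))

-- A unitary divisor q ^ i with 0 < i < a + 1 would share the factor q with its cofactor.
τ*-prime-power≤2 : ∀ {q} → Prime q → ∀ a → τ* (q ^ suc a) ≤ 2
τ*-prime-power≤2 {q} prime-q a = unique-⊆⇒length-≤ _≟_
  (unitaryDivisors-unique (q ^ suc a)) ((<⇒≢ 1<qᵃ⁺¹ ∷ []) ∷ [] ∷ []) ⊆ends
  where
  1<q = prime⇒>1 prime-q
  instance _ = >-nonZero (<-trans z<s 1<q)
  instance _ = m^n≢0 q (suc a)
  1<qᵃ⁺¹ : 1 < q ^ suc a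
  1<qᵃ⁺¹ = ^-monoʳ-< q 1<q {0} {suc a} z<s
  q∣qⁱ : ∀ {i} → 0 < i → q ∣ q ^ i
  q∣qⁱ {i} 0<i = subst (_∣ q ^ i) (*-identityʳ q) (^-monoʳ-∣ q {1} {i} 0<i)
  ⊆ends : ∀ {x} → x ∈ unitaryDivisors (q ^ suc a) → x ∈ 1 ∷ q ^ suc a ∷ []
  ⊆ends x∈ with ∈-unitaryDivisors⁻ {m = q ^ suc a} x∈
  ... | x∣qᵃ⁺¹ , coprime with ∣-prime-power prime-q (suc a) x∣qᵃ⁺¹
  ... | zero , _ , refl = here refl
  ... | suc i , i<a+1 , refl with suc i ≟ suc a
  ...   | yes refl = there (here refl)
  ...   | no  i≢a  = contradiction (coprime (q∣qⁱ {suc i} z<s , q∣cofactor)) (<⇒≢ 1<q ∘ sym)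
    where
    j = suc a ∸ suc i
    q∣cofactor : q ∣ q ^ suc a ÷ q ^ suc i
    q∣cofactor = subst (q ∣_) (sym (begin
      q ^ suc a ÷ q ^ suc i               ≡⟨ cong (λ k → q ^ k ÷ q ^ suc i) (m+[n∸m]≡n i<a+1) ⟨
      q ^ (suc i + j) ÷ q ^ suc i         ≡⟨ cong (_÷ q ^ suc i) (^-distribˡ-+-* q (suc i) j) ⟩
      q ^ suc i * q ^ j ÷ q ^ suc i       ≡⟨ m*n÷m≡n (q ^ suc i) (q ^ j) {{m^n≢0 q (suc i)}} ⟩
      q ^ j                               ∎))
      (q∣qⁱ {j} (m<n⇒0<n∸m (≤∧≢⇒< i<a+1 i≢a)))
      where open ≡-Reasoning

-- Perfect numbers

record PerfectExponents (k n w : ℕ) : Set where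
  field
    τ*≡w*2 : τ* n ≡ w * 2
    w*τ≡2k : w * τ (n ^ w) ≡ 2 * k

open PerfectExponents

perfect⇒exponents : ∀ {k n} → 1 < n → IsKT0T*Perfect k n → ∃ (PerfectExponents k n)
perfect⇒exponents {k} {n} 1<n T[T*n]≡nᵏ with τ*-even 1<n
... | divides w τ*≡w*2 = w , record { τ*≡w*2 = τ*≡w*2 ; w*τ≡2k = ^-injectiveʳ 1<n n^[wt]≡n^[2k] }
  where
  open ≡-Reasoning
  T*n≡nʷ : T* n ≡ n ^ w
  T*n≡nʷ = m*m≡n*n⇒m≡n (begin
    T* n * T* n      ≡⟨ T*-square n ⟩
    n ^ τ* n         ≡⟨ cong (n ^_) τ*≡w*2 ⟩
    n ^ (w * 2)      ≡⟨ ^-*-assoc n w 2 ⟨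
    (n ^ w) ^ 2      ≡⟨ cong (n ^ w *_) (*-identityʳ (n ^ w)) ⟩
    n ^ w * n ^ w    ∎)
  n^[wt]≡n^[2k] : n ^ (w * τ (n ^ w)) ≡ n ^ (2 * k)
  n^[wt]≡n^[2k] = begin
    n ^ (w * τ (n ^ w))    ≡⟨ ^-*-assoc n w _ ⟨
    (n ^ w) ^ τ (n ^ w)    ≡⟨ T-square (n ^ w) ⟨
    T (n ^ w) * T (n ^ w)  ≡⟨ cong (λ m → T m * T m) T*n≡nʷ ⟨
    T (T* n) * T (T* n)    ≡⟨ cong₂ _*_ T[T*n]≡nᵏ T[T*n]≡nᵏ ⟩
    n ^ k * n ^ k          ≡⟨ ^-distribˡ-+-* n k k ⟨
    n ^ (k + k)            ≡⟨ cong (λ j → n ^ (k + j)) (+-identityʳ k) ⟨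
    n ^ (2 * k)            ∎

prime-power-exponents : ∀ {k n q a w} → .{{NonZero k}} → Prime q → n ≡ q ^ suc a →
  PerfectExponents k n w → n ≡ q ^ (2 * k ∸ 1)
prime-power-exponents {k} {w = zero} _ _ exps =
  contradiction (sym (w*τ≡2k exps)) (≢-nonZero⁻¹ (2 * k) {{m*n≢0 2 k}})
prime-power-exponents {a = a} {w = suc (suc _)} prime-q refl exps =
  contradiction (subst (_≤ 2) (τ*≡w*2 exps) (τ*-prime-power≤2 prime-q a)) λ { (s≤s (s≤s ())) }
prime-power-exponents {k} {q = q} {a} {w = 1} prime-q refl exps = cong (λ i → q ^ (i ∸ 1)) (begin
  suc (suc a)               ≡⟨ τ-prime-power prime-q (suc a) ⟨
  τ (q ^ suc a)             ≡⟨ cong τ (*-identityʳ (q ^ suc a)) ⟨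
  τ ((q ^ suc a) ^ 1)       ≡⟨ +-identityʳ _ ⟨
  1 * τ ((q ^ suc a) ^ 1)   ≡⟨ w*τ≡2k exps ⟩
  2 * k                     ∎)
  where open ≡-Reasoning

split-¬exponents : ∀ {k n q a e w} → Prime k → Prime q → q ∤ e → 1 < e → n ≡ q ^ suc a * e →
  ¬ PerfectExponents k n w
split-¬exponents {k} {q = q} {a} {e} {w} prime-k prime-q q∤e 1<e refl exps =
  nontrivial-a*[b*c]≢2*prime prime-k 1<w (s≤s (≤-trans (<⇒≤ 1<w) (m≤m+n w (a * w)))) (τ≥2 1<eʷ)
    (trans (cong (w *_) (sym τ[nʷ]≡)) (w*τ≡2k exps))
  where
  open ≡-Reasoning
  1<q = prime⇒>1 prime-q
  instance
    _ = >-nonZero (<-trans z<s 1<q)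
    _ = >-nonZero (<-trans z<s 1<e)
    _ = m^n≢0 q (suc a * w)
    _ = m^n≢0 e w
  1<w : 1 < w
  1<w = *-cancelʳ-< 2 1 w (≤-trans (n≤1+n 3) (≤-trans
    (τ*-coprime≥4 (^-monoʳ-< q 1<q {0} {suc a} z<s) 1<e (prime-power-coprime prime-q q∤e (suc a)))
    (≤-reflexive (τ*≡w*2 exps))))
  q∤eʷ = prime-∤-^ prime-q q∤e w
  1<eʷ : 1 < e ^ w
  1<eʷ = ^-monoʳ-< e 1<e {0} {w} (<-trans z<s 1<w)
  τ[nʷ]≡ : τ ((q ^ suc a * e) ^ w) ≡ suc (suc a * w) * τ (e ^ w)
  τ[nʷ]≡ = begin
    τ ((q ^ suc a * e) ^ w)          ≡⟨ cong τ (^-distribʳ-* (q ^ suc a) e w) ⟩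
    τ ((q ^ suc a) ^ w * e ^ w)      ≡⟨ cong (λ x → τ (x * e ^ w)) (^-*-assoc q (suc a) w) ⟩
    τ (q ^ (suc a * w) * e ^ w)      ≡⟨ τ-*-coprime (prime-power-coprime prime-q q∤eʷ (suc a * w)) ⟩
    τ (q ^ (suc a * w)) * τ (e ^ w)  ≡⟨ cong (_* τ (e ^ w)) (τ-prime-power prime-q (suc a * w)) ⟩
    suc (suc a * w) * τ (e ^ w)      ∎

theorem3p2 : (p : ℕ) → Prime p → (n : ℕ) → 1 < n → IsKT0T*Perfect p n →
    Σ ℕ (λ p₁ → Prime p₁ × n ≡ p₁ ^ (2 * p ∸ 1))
theorem3p2 p prime-p n 1<n perfect
  with q , prime-q , q∣n ← ∃-prime-divisor 1<n
  with a , e , n≡qᵃ⁺¹e , q∤e ← prime-power-part (prime⇒>1 prime-q) q∣n {{>-nonZero (<-trans z<s 1<n)}}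
  with w , exps ← perfect⇒exponents {p} 1<n perfect
  with e
... | zero =
  contradiction (sym (trans n≡qᵃ⁺¹e (*-zeroʳ (q ^ suc a)))) (<⇒≢ (<-trans z<s 1<n))
... | 1 = q , prime-q ,
  prime-power-exponents {a = a} {{prime⇒nonZero prime-p}} prime-q (trans n≡qᵃ⁺¹e (*-identityʳ _)) exps
... | suc (suc _) =
  contradiction exps (split-¬exponents {a = a} prime-p prime-q q∤e (s≤s (s≤s z≤n)) n≡qᵃ⁺¹e)
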